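{- Let $T,S\subseteq\mathbb{Z}_{>0}$ be finite and let $T'\subseteq T$ with $T\triangleleft S\subseteq T'$. Then $T\triangleleft S=T'\triangleleft S$.
   Context: For finite $T,S\subseteq\mathbb{Z}_{>0}$, $T\triangleleft S$ is computed by going through $s\in S$ from largest to smallest; each $s$ picks the largest not-yet-picked $t\in T$ with $t<s$, if one exists; $T\triangleleft S$ is the set of picked elements. -}

module Defs where

open import Data.Nat using (ℕ; _<_; _<?_; _≟_)
open import Data.List using (List; []; _∷_; filter)
open import Data.Maybe using (Maybe; nothing; just)
open import Relation.Nullary using (yes; no; ¬?)

-- Finite sets of positive integers are represented by duplicate-free lists
-- (the hypotheses Unique / All (0 <_) are imposed in the statement).

max′ : ℕ → ℕ → ℕ
max′ x y with x <? y
... | yes _ = y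
... | no  _ = x

largestBelow : ℕ → List ℕ → Maybe ℕ
largestBelow s [] = nothing
largestBelow s (x ∷ xs) with x <? s | largestBelow s xs
... | yes _ | nothing = just x
... | yes _ | just y  = just (max′ x y)
... | no  _ | r       = r

remove : ℕ → List ℕ → List ℕ
remove t = filter (λ x → ¬? (x ≟ t))

pickAll : List ℕ → List ℕ → List ℕ
pickAll [] avail = []
pickAll (s ∷ ss) avail with largestBelow s avail
... | nothing = pickAll ss avail
... | just t  = t ∷ pickAll ss (remove t avail)

insertDesc : ℕ → List ℕ → List ℕ
insertDesc x [] = x ∷ []
insertDesc x (y ∷ ys) with y <? x
... | yes _ = x ∷ y ∷ ys
... | no  _ = y ∷ insertDesc x ys

sortDesc : List ℕ → List ℕ
sortDesc [] = []
sortDesc (x ∷ xs) = insertDesc x (sortDesc xs)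

-- T ◁ S : go through s ∈ S from largest to smallest; each s picks the
-- largest not-yet-picked t ∈ T with t < s, if one exists.
_◁_ : List ℕ → List ℕ → List ℕ
T ◁ S = pickAll (sortDesc S) T

{-# OPTIONS --safe #-}
-- Shrinking the pool from T to T′ does not change any choice: whenever s
-- picks t from T, t lies in T′ and nothing in T′ below s exceeds t; and
-- whenever s picks nothing from T, there is nothing to pick from T′ either.
-- After the step both pools lose t, so the invariant persists.
module Submission where

open import Defs
open import Data.Nat using (ℕ; _<_; _≤_; _<?_; _≟_)
open import Data.Nat.Properties using (<⇒≤; ≮⇒≥; ≤-antisym; ≤-trans; ≤-refl)
open import Data.List using (List; []; _∷_)
open import Data.List.Relation.Unary.All using (All)
open import Data.List.Relation.Unary.Any using (here; there)
open import Data.List.Relation.Unary.Unique.Propositional using (Unique)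
open import Data.List.Relation.Binary.Subset.Propositional using (_⊆_)
open import Data.List.Membership.Propositional using (_∈_)
open import Data.List.Membership.Propositional.Properties using (∈-filter⁺; ∈-filter⁻)
open import Function.Bundles using (_⇔_)
open import Data.Maybe using (Maybe; nothing; just)
open import Data.Product using (_×_; _,_; proj₁; proj₂)
open import Data.Sum using (_⊎_; inj₁; inj₂)
open import Data.Empty using (⊥-elim)
open import Relation.Nullary using (¬_; ¬?; yes; no)
open import Relation.Binary.PropositionalEquality using (_≡_; refl; cong)
open import Function.Properties.Equivalence using () renaming (refl to ⇔-refl)

data LargestBelow (s : ℕ) (L : List ℕ) : Maybe ℕ → Set where
  none : (∀ {x} → x ∈ L → ¬ x < s) → LargestBelow s L nothing
  some : ∀ {t} → t ∈ L → t < s → (∀ {x} → x ∈ L → x < s → x ≤ t) →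
         LargestBelow s L (just t)

max′-cases : ∀ x y → (max′ x y ≡ x × y ≤ x) ⊎ (max′ x y ≡ y × x ≤ y)
max′-cases x y with x <? y
... | yes x<y = inj₂ (refl , <⇒≤ x<y)
... | no  x≮y = inj₁ (refl , ≮⇒≥ x≮y)

largestBelow-spec : ∀ s L → LargestBelow s L (largestBelow s L)
largestBelow-spec s [] = none (λ ())
largestBelow-spec s (x ∷ xs) with x <? s | largestBelow s xs | largestBelow-spec s xs
... | yes x<s | nothing | none below = some (here refl) x<s bound
  where
    bound : ∀ {z} → z ∈ x ∷ xs → z < s → z ≤ x
    bound (here refl) _   = ≤-refl
    bound (there z∈) z<s = ⊥-elim (below z∈ z<s)
... | yes x<s | just y | some y∈ y<s y-max with max′-cases x y
...   | inj₁ (eq , y≤x) rewrite eq = some (here refl) x<s bound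
  where
    bound : ∀ {z} → z ∈ x ∷ xs → z < s → z ≤ x
    bound (here refl) _   = ≤-refl
    bound (there z∈) z<s = ≤-trans (y-max z∈ z<s) y≤x
...   | inj₂ (eq , x≤y) rewrite eq = some (there y∈) y<s bound
  where
    bound : ∀ {z} → z ∈ x ∷ xs → z < s → z ≤ y
    bound (here refl) _   = x≤y
    bound (there z∈) z<s = y-max z∈ z<s
largestBelow-spec s (x ∷ xs) | no x≮s | _ | none below = none below′
  where
    below′ : ∀ {z} → z ∈ x ∷ xs → ¬ z < s
    below′ (here refl) = x≮s
    below′ (there z∈)  = below z∈
largestBelow-spec s (x ∷ xs) | no x≮s | _ | some y∈ y<s y-max = some (there y∈) y<s bound
  where
    bound : ∀ {z} → z ∈ x ∷ xs → z < s → z ≤ _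
    bound (here refl) z<s = ⊥-elim (x≮s z<s)
    bound (there z∈) z<s  = y-max z∈ z<s

∈-remove⁺ : ∀ {t x L} → x ∈ L → ¬ x ≡ t → x ∈ remove t L
∈-remove⁺ {t} = ∈-filter⁺ (λ x → ¬? (x ≟ t))

∈-remove⁻ : ∀ t {x} L → x ∈ remove t L → x ∈ L × ¬ x ≡ t
∈-remove⁻ t L = ∈-filter⁻ (λ x → ¬? (x ≟ t)) {xs = L}

remove-mono : ∀ t {A B} → B ⊆ A → remove t B ⊆ remove t A
remove-mono t {B = B} B⊆A x∈ =
  let x∈B , x≢t = ∈-remove⁻ t B x∈ in ∈-remove⁺ (B⊆A x∈B) x≢t

pickAll-⊆ : ∀ ss P → pickAll ss P ⊆ P
pickAll-⊆ []       P ()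
pickAll-⊆ (s ∷ ss) P with largestBelow s P | largestBelow-spec s P
... | nothing | _ = pickAll-⊆ ss P
... | just t  | some t∈ _ _ = λ where
  (here refl) → t∈
  (there x∈)  → proj₁ (∈-remove⁻ t P (pickAll-⊆ ss (remove t P) x∈))

pickAll-restrict : ∀ ss {A B} → B ⊆ A → pickAll ss A ⊆ B → pickAll ss B ≡ pickAll ss A
pickAll-restrict [] _ _ = refl
pickAll-restrict (s ∷ ss) {A} {B} B⊆A picked⊆B
  with largestBelow s A | largestBelow-spec s A | largestBelow s B | largestBelow-spec s B
... | nothing | _ | nothing | _ = pickAll-restrict ss B⊆A picked⊆B
... | nothing | none belowA | just u | some u∈ u<s _ = ⊥-elim (belowA (B⊆A u∈) u<s)
... | just t | some _ t<s _ | nothing | none belowB = ⊥-elim (belowB (picked⊆B (here refl)) t<s)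
... | just t | some _ t<s t-max | just u | some u∈ u<s u-max
  with ≤-antisym (u-max (picked⊆B (here refl)) t<s) (t-max (B⊆A u∈) u<s)
...   | refl = cong (t ∷_) (pickAll-restrict ss (remove-mono t B⊆A) rest⊆)
  where
    rest⊆ : pickAll ss (remove t A) ⊆ remove t B
    rest⊆ x∈ = ∈-remove⁺ (picked⊆B (there x∈))
                         (proj₂ (∈-remove⁻ t A (pickAll-⊆ ss (remove t A) x∈)))

corollary4p4 : (T S T′ : List ℕ)
    → Unique T → All (0 <_) T
    → Unique S → All (0 <_) S
    → Unique T′ → T′ ⊆ T
    → (T ◁ S) ⊆ T′
    → (x : ℕ) → (x ∈ (T ◁ S)) ⇔ (x ∈ (T′ ◁ S))
corollary4p4 T S T′ _ _ _ _ _ T′⊆T T◁S⊆T′ x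
  rewrite pickAll-restrict (sortDesc S) T′⊆T T◁S⊆T′ = ⇔-refl
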